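{- Let $S\subseteq\mathbb{Z}_2^n\setminus\{0\}$. Then: (1) $q_0(S)=2^{ -\mathrm{rank}(S)}$; (2) $q_1(S)=m(S)\,q_0(S)=m(S)2^{ -\mathrm{rank}(S)}$; (3) if there is $i\in[n]$ such that $|\{v\in S: v_i=1\}|$ is odd, then $q_k(S)\le1/2$ for every $k\ge0$; (4) for every odd $k$, $q_k(S)\le1/2$; (5) $q_2(S)\le 3/4$.
   Context: $\langle x,y\rangle=\sum_i x_iy_i$ on $\mathbb{Z}_2^n$. Let $w$ be uniformly random in $\mathbb{Z}_2^n$ and $A_w=\{v:\langle v,w\rangle=1\}$; $q_k(S)=\Pr[|S\cap A_w|=k]$. $\mathrm{rank}(S)$ is the dimension of the span of $S$. $I(S)=\{v\in S: v\notin\mathrm{Span}(S\setminus\{v\})\}$ and $m(S)=|I(S)|$. -}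

module Defs where

open import Data.Bool using (Bool; true; false; _∧_; _xor_; if_then_else_)
import Data.Bool as B
open import Data.Nat using (ℕ; zero; suc; _^_)
import Data.Nat as N
open import Data.Nat.Properties using (m^n≢0)
open import Data.Integer using (+_)
open import Data.Rational using (ℚ; _/_)
open import Data.Fin using (Fin)
import Data.Fin as F
open import Data.Vec using (Vec; []; _∷_; replicate; zipWith; foldr′)
import Data.Vec.Properties as VP
open import Data.List using (List; []; _∷_; length; filter; map; _++_)
open import Data.List.Membership.Propositional using (_∈_)
open import Data.List.Relation.Unary.All using (All)
open import Data.Product using (Σ; _×_)
open import Relation.Binary.PropositionalEquality using (_≡_; _≢_)
open import Relation.Nullary.Negation using (¬_)
open import Relation.Nullary.Decidable using (¬?; Dec)

-- Vectors of 𝔽₂ⁿ are Vec Bool n (true = 1, false = 0), addition is xor.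
V : ℕ → Set
V n = Vec Bool n

zeroV : ∀ {n} → V n
zeroV = replicate _ false

_⊕_ : ∀ {n} → V n → V n → V n
_⊕_ = zipWith _xor_

⟨_,_⟩ : ∀ {n} → V n → V n → Bool
⟨ x , y ⟩ = foldr′ _xor_ false (zipWith _∧_ x y)

_≟V_ : ∀ {n} (u v : V n) → Dec (u ≡ v)
_≟V_ = VP.≡-dec B._≟_

comb : ∀ {n} (T : List (V n)) → (Fin (length T) → Bool) → V n
comb []      c = zeroV
comb (u ∷ T) c = if c F.zero then u ⊕ comb T (λ i → c (F.suc i)) else comb T (λ i → c (F.suc i))

InSpan : ∀ {n} → V n → List (V n) → Set
InSpan v T = Σ (Fin (length T) → Bool) (λ c → comb T c ≡ v)

LinIndep : ∀ {n} → List (V n) → Set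
LinIndep Bs = ∀ c → comb Bs c ≡ zeroV → ∀ i → c i ≡ false

IsBasisOfSpan : ∀ {n} → List (V n) → List (V n) → Set
IsBasisOfSpan S Bs = LinIndep Bs × All (λ b → InSpan b S) Bs × All (λ v → InSpan v Bs) S

HasRank : ∀ {n} → List (V n) → ℕ → Set
HasRank S r = Σ (List _) (λ Bs → IsBasisOfSpan S Bs × length Bs ≡ r)

remove : ∀ {n} → V n → List (V n) → List (V n)
remove v S = filter (λ u → ¬? (u ≟V v)) S

InI : ∀ {n} → List (V n) → V n → Set
InI S v = v ∈ S × ¬ InSpan v (remove v S)

allVecs : ∀ n → List (V n)
allVecs zero    = [] ∷ []
allVecs (suc n) = map (true ∷_) (allVecs n) ++ map (false ∷_) (allVecs n)

-- A_w = {v : ⟨v,w⟩ = 1};  |S ∩ A_w|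
capSize : ∀ {n} → List (V n) → V n → ℕ
capSize S w = length (filter (λ v → ⟨ v , w ⟩ B.≟ true) S)

-- q_k(S) = Pr_w[|S ∩ A_w| = k] for w uniform in 𝔽₂ⁿ
q : ∀ {n} → ℕ → List (V n) → ℚ
q {n} k S = (+ length (filter (λ w → capSize S w N.≟ k) (allVecs n))) / (2 ^ n)
  where instance _ = m^n≢0 2 n

countCoord : ∀ {n} → List (V n) → Fin n → ℕ
countCoord S i = length (filter (λ v → Data.Vec.lookup v i B.≟ true) S)

-- The w with S ∩ A_w = ∅ are those
-- orthogonal to Span S: appending a vector v outside the span of a list T halves their number,
-- because translating by some w′ ⊥ T with ⟨v,w′⟩ = 1 exchanges the w ⊥ T with ⟨v,w⟩ = 0 and those
-- with ⟨v,w⟩ = 1; along a basis this gives 2^(n - rank S).  Next, |S ∩ A_w| = 1 exactly when one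
-- v ∈ S has ⟨v,w⟩ = 1 and w ⊥ S ∖ {v}; by the same translation there are as many such w as
-- w ⊥ S when v ∈ I(S), and none otherwise.
-- For the bounds, |S ∩ A_{w⊕e}| ≡ |S ∩ A_w| + |S ∩ A_e| (mod 2).  If |S ∩ A_e| is odd, w and w ⊕ e
-- never both meet S in k points, so q_k ≤ 1/2; this covers (3) with e a unit vector, and (4) unless
-- every |S ∩ A_w| is even, when q_k = 0.  For (5) fix e with |S ∩ A_e| = 2.  If no f has
-- |S ∩ A_f| = |S ∩ A_{e⊕f}| = 2, pairing w with w ⊕ e gives q₂ ≤ 1/2; otherwise each coset of
-- {0, e, f, e ⊕ f} has at most three w with |S ∩ A_w| = 2, since for all four S ∩ A_w would meet
-- A_e, A_f and A_{e⊕f} in one point each, against parity.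

module Submission where

open import Defs
open import Algebra.Bundles using (CommutativeRing)
open import Data.Bool using (Bool; true; false; not; _∧_; _∨_; _xor_)
import Data.Bool as B
open import Data.Bool.Properties
  using ( xor-comm; xor-assoc; xor-identityˡ; xor-identityʳ; xor-same; not-involutive
        ; not-distribˡ-xor; not-¬; ∧-comm; ∧-conicalˡ; ∧-conicalʳ; ∧-zeroʳ; ∧-identityʳ; ∧-distribˡ-xor
        ; ⇔→≡; T-≡; xor-∧-commutativeRing )
open import Data.Fin using (Fin)
import Data.Fin as Fin
import Data.Integer as ℤ
import Data.Integer.Properties as ℤ
open import Data.List using (List; []; _∷_; length; filter; filterᵇ; map; _++_)
open import Data.List.Membership.Propositional using (_∈_)
open import Data.List.Membership.Propositional.Properties using (∈-filter⁺; ∈-filter⁻)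
open import Data.List.Properties using (filter-accept; filter-reject; filter-all)
open import Data.List.Relation.Unary.All as All using (All; []; _∷_)
open import Data.List.Relation.Unary.All.Properties using (All¬⇒¬Any)
open import Data.List.Relation.Unary.Any as Any using (here; there)
open import Data.List.Relation.Unary.AllPairs using ([]; _∷_)
open import Data.List.Relation.Unary.Unique.Propositional using (Unique)
open import Data.Nat using (ℕ; zero; suc; _+_; _^_; _%_; _≡ᵇ_; z≤n; s≤s; NonZero)
import Data.Nat as ℕ
open import Data.Nat.Properties
  using ( +-identityʳ; +-assoc; +-comm; *-identityʳ; *-identityˡ; *-suc; *-assoc; *-comm; *-zeroʳ
        ; *-distribʳ-+
        ; +-mono-≤; *-monoˡ-≤; ≤-reflexive; ≤-trans; ≤-pred; n≤1+n
        ; +-cancelˡ-≡; ≡ᵇ⇒≡; m^n≢0; m+1+n≢0; module ≤-Reasoning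
        ; +-commutativeSemigroup )
open import Data.Nat.Tactic.RingSolver using (solve-∀)
open import Data.Product using (∃-syntax; _×_; _,_; proj₁)
open import Data.Rational using (_/_; _*_; _≤_; ½; toℚᵘ)
open import Data.Rational.Properties
  using (fromℚᵘ-cong; toℚᵘ-fromℚᵘ; toℚᵘ-cancel-≤; toℚᵘ-injective; toℚᵘ-homo-*)
import Data.Rational.Unnormalised as ℚᵘ
import Data.Rational.Unnormalised.Properties as ℚᵘ
open import Data.Sum using (_⊎_; inj₁; inj₂)
open import Data.Vec using (Vec; []; _∷_; lookup)
open import Data.Vec.Properties using (zipWith-comm; zipWith-assoc; zipWith-identityˡ; zipWith-identityʳ)
import Data.Vec.Functional as Coefficients
open import Function using (_∘_)
open import Function.Bundles using (_⇔_; mk⇔; Equivalence)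
open import Relation.Binary.PropositionalEquality
  using (_≡_; _≢_; refl; sym; trans; cong; cong₂; subst; subst₂; module ≡-Reasoning)
open import Relation.Nullary using (Dec; yes; no; does; ¬_; ¬?; contradiction)
open import Relation.Nullary.Decidable using (dec-true; dec-false)

open import Algebra.Properties.CommutativeSemigroup +-commutativeSemigroup
  using () renaming (interchange to +-interchange)
open import Algebra.Properties.CommutativeSemigroup
  (CommutativeRing.+-commutativeSemigroup xor-∧-commutativeRing)
  using () renaming (interchange to xor-interchange)

𝟙 : Bool → ℕ
𝟙 true  = 1
𝟙 false = 0

𝟙-xor : ∀ a b → 𝟙 (a xor b) + (𝟙 (a ∧ b) + 𝟙 (a ∧ b)) ≡ 𝟙 a + 𝟙 b
𝟙-xor false false = refl
𝟙-xor false true  = refl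
𝟙-xor true  false = refl
𝟙-xor true  true  = refl

𝟙-split : ∀ a b → 𝟙 b ≡ 𝟙 (not a ∧ b) + 𝟙 (a ∧ b)
𝟙-split true  b = refl
𝟙-split false b = sym (+-identityʳ (𝟙 b))

𝟙-∨ : ∀ {a b} → (a ≡ true → b ≡ false) → 𝟙 (a ∨ b) ≡ 𝟙 a + 𝟙 b
𝟙-∨ {false} _     = refl
𝟙-∨ {true}  a⇒¬b rewrite a⇒¬b refl = refl

isOdd : ℕ → Bool
isOdd zero    = false
isOdd (suc m) = not (isOdd m)

isOdd-+ : ∀ m n → isOdd (m + n) ≡ isOdd m xor isOdd n
isOdd-+ zero    n = refl
isOdd-+ (suc m) n = trans (cong not (isOdd-+ m n)) (not-distribˡ-xor (isOdd m) (isOdd n))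

isOdd-double : ∀ m → isOdd (m + m) ≡ false
isOdd-double m = trans (isOdd-+ m m) (xor-same (isOdd m))

%2≡1⇒isOdd : ∀ m → m % 2 ≡ 1 → isOdd m ≡ true
%2≡1⇒isOdd (suc zero)    _  = refl
%2≡1⇒isOdd (suc (suc m)) eq = trans (not-involutive (isOdd m)) (%2≡1⇒isOdd m eq)

≡ᵇ-true⇒≡ : ∀ m n → (m ≡ᵇ n) ≡ true → m ≡ n
≡ᵇ-true⇒≡ m n eq = ≡ᵇ⇒≡ m n (Equivalence.from T-≡ eq)

does-≟-true : ∀ b → does (b B.≟ true) ≡ b
does-≟-true false = refl
does-≟-true true  = refl

m+m≡2⇒m≡1 : ∀ m → m + m ≡ 2 → m ≡ 1
m+m≡2⇒m≡1 (suc zero)    _  = refl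
m+m≡2⇒m≡1 (suc (suc m)) eq = contradiction (cong (ℕ.pred ∘ ℕ.pred) eq) (m+1+n≢0 m)

sumL : ∀ {a} {A : Set a} → (A → ℕ) → List A → ℕ
sumL f []       = 0
sumL f (x ∷ xs) = f x + sumL f xs

count : ∀ {a} {A : Set a} → (A → Bool) → List A → ℕ
count p = sumL (λ x → 𝟙 (p x))

module _ {a} {A : Set a} where

  sumL-cong : ∀ {f g : A → ℕ} xs → (∀ {x} → x ∈ xs → f x ≡ g x) → sumL f xs ≡ sumL g xs
  sumL-cong []       _   = refl
  sumL-cong (x ∷ xs) f≗g = cong₂ _+_ (f≗g (here refl)) (sumL-cong xs (f≗g ∘ there))

  sumL-+ : ∀ (f g : A → ℕ) xs → sumL (λ x → f x + g x) xs ≡ sumL f xs + sumL g xs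
  sumL-+ f g []       = refl
  sumL-+ f g (x ∷ xs) =
    trans (cong (f x + g x +_) (sumL-+ f g xs)) (+-interchange (f x) (g x) (sumL f xs) (sumL g xs))

  sumL-++ : ∀ (f : A → ℕ) xs ys → sumL f (xs ++ ys) ≡ sumL f xs + sumL f ys
  sumL-++ f []       ys = refl
  sumL-++ f (x ∷ xs) ys = trans (cong (f x +_) (sumL-++ f xs ys)) (sym (+-assoc (f x) _ _))

  sumL-map : ∀ {b} {B : Set b} (f : B → ℕ) (g : A → B) xs → sumL f (map g xs) ≡ sumL (f ∘ g) xs
  sumL-map f g []       = refl
  sumL-map f g (x ∷ xs) = cong (f (g x) +_) (sumL-map f g xs)

  sumL-const : ∀ c (xs : List A) → sumL (λ _ → c) xs ≡ c ℕ.* length xs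
  sumL-const c []       = sym (*-zeroʳ c)
  sumL-const c (x ∷ xs) = trans (cong (c +_) (sumL-const c xs)) (sym (*-suc c (length xs)))

  sumL-*ʳ : ∀ (f : A → ℕ) c xs → sumL (λ x → f x ℕ.* c) xs ≡ sumL f xs ℕ.* c
  sumL-*ʳ f c []       = refl
  sumL-*ʳ f c (x ∷ xs) = trans (cong (f x ℕ.* c +_) (sumL-*ʳ f c xs)) (sym (*-distribʳ-+ c (f x) _))

  count-xor : ∀ (p r : A → Bool) xs →
    count (λ x → p x xor r x) xs + (count (λ x → p x ∧ r x) xs + count (λ x → p x ∧ r x) xs)
    ≡ count p xs + count r xs
  count-xor p r xs = begin
    count p⊕r xs + (count p∧r xs + count p∧r xs)
      ≡⟨ cong (count p⊕r xs +_) (sumL-+ (𝟙 ∘ p∧r) (𝟙 ∘ p∧r) xs) ⟨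
    count p⊕r xs + sumL (λ x → 𝟙 (p∧r x) + 𝟙 (p∧r x)) xs
      ≡⟨ sumL-+ (𝟙 ∘ p⊕r) _ xs ⟨
    sumL (λ x → 𝟙 (p⊕r x) + (𝟙 (p∧r x) + 𝟙 (p∧r x))) xs
      ≡⟨ sumL-cong xs (λ {x} _ → 𝟙-xor (p x) (r x)) ⟩
    sumL (λ x → 𝟙 (p x) + 𝟙 (r x)) xs
      ≡⟨ sumL-+ (𝟙 ∘ p) (𝟙 ∘ r) xs ⟩
    count p xs + count r xs ∎
    where
    open ≡-Reasoning
    p⊕r p∧r : A → Bool
    p⊕r x = p x xor r x
    p∧r x = p x ∧ r x

  count-filterᵇ : ∀ (p r : A → Bool) xs → count r (filterᵇ p xs) ≡ count (λ x → p x ∧ r x) xs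
  count-filterᵇ p r []       = refl
  count-filterᵇ p r (x ∷ xs) with p x
  ... | true  = cong (𝟙 (r x) +_) (count-filterᵇ p r xs)
  ... | false = count-filterᵇ p r xs

  count-false : ∀ {p : A → Bool} xs → (∀ {x} → x ∈ xs → p x ≡ false) → count p xs ≡ 0
  count-false xs p≗false = trans (sumL-cong xs (cong 𝟙 ∘ p≗false)) (sumL-const 0 xs)

  count-≤-length : ∀ (p : A → Bool) xs → count p xs ℕ.≤ length xs
  count-≤-length p []       = z≤n
  count-≤-length p (x ∷ xs) with p x
  ... | true  = s≤s (count-≤-length p xs)
  ... | false = ≤-trans (count-≤-length p xs) (n≤1+n _)

  count-<-length : ∀ (p : A → Bool) xs → ¬ All (λ x → p x ≡ true) xs → count p xs ℕ.< length xs
  count-<-length p []       ¬all = contradiction [] ¬all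
  count-<-length p (x ∷ xs) ¬all with p x in px
  ... | true  = s≤s (count-<-length p xs (¬all ∘ (px ∷_)))
  ... | false = s≤s (count-≤-length p xs)

  length-filter : ∀ {ℓ} {P : A → Set ℓ} (P? : ∀ x → Dec (P x)) xs →
    length (filter P? xs) ≡ count (λ x → does (P? x)) xs
  length-filter P? []       = refl
  length-filter P? (x ∷ xs) with does (P? x)
  ... | true  = cong suc (length-filter P? xs)
  ... | false = length-filter P? xs

-- The space 𝔽₂ⁿ

⊕-comm : ∀ {n} (x y : V n) → x ⊕ y ≡ y ⊕ x
⊕-comm = zipWith-comm xor-comm

⊕-assoc : ∀ {n} (x y z : V n) → (x ⊕ y) ⊕ z ≡ x ⊕ (y ⊕ z)
⊕-assoc = zipWith-assoc xor-assoc

⊕-identityˡ : ∀ {n} (x : V n) → zeroV ⊕ x ≡ x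
⊕-identityˡ = zipWith-identityˡ xor-identityˡ

⊕-identityʳ : ∀ {n} (x : V n) → x ⊕ zeroV ≡ x
⊕-identityʳ = zipWith-identityʳ xor-identityʳ

⊕-self : ∀ {n} (x : V n) → x ⊕ x ≡ zeroV
⊕-self []      = refl
⊕-self (a ∷ x) = cong₂ _∷_ (xor-same a) (⊕-self x)

⊕-cancelˡ : ∀ {n} (x y : V n) → x ⊕ (x ⊕ y) ≡ y
⊕-cancelˡ x y = begin
  x ⊕ (x ⊕ y) ≡⟨ ⊕-assoc x x y ⟨
  (x ⊕ x) ⊕ y ≡⟨ cong (_⊕ y) (⊕-self x) ⟩
  zeroV ⊕ y   ≡⟨ ⊕-identityˡ y ⟩
  y           ∎
  where open ≡-Reasoning

⟨⟩-comm : ∀ {n} (x y : V n) → ⟨ x , y ⟩ ≡ ⟨ y , x ⟩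
⟨⟩-comm []      []      = refl
⟨⟩-comm (a ∷ x) (b ∷ y) = cong₂ _xor_ (∧-comm a b) (⟨⟩-comm x y)

⟨⟩-distribʳ-⊕ : ∀ {n} (x y z : V n) → ⟨ x , y ⊕ z ⟩ ≡ ⟨ x , y ⟩ xor ⟨ x , z ⟩
⟨⟩-distribʳ-⊕ []      []      []      = refl
⟨⟩-distribʳ-⊕ (a ∷ x) (b ∷ y) (c ∷ z) =
  trans (cong₂ _xor_ (∧-distribˡ-xor a b c) (⟨⟩-distribʳ-⊕ x y z))
        (xor-interchange (a ∧ b) (a ∧ c) ⟨ x , y ⟩ ⟨ x , z ⟩)

⟨⟩-distribˡ-⊕ : ∀ {n} (x y z : V n) → ⟨ x ⊕ y , z ⟩ ≡ ⟨ x , z ⟩ xor ⟨ y , z ⟩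
⟨⟩-distribˡ-⊕ x y z = begin
  ⟨ x ⊕ y , z ⟩             ≡⟨ ⟨⟩-comm (x ⊕ y) z ⟩
  ⟨ z , x ⊕ y ⟩             ≡⟨ ⟨⟩-distribʳ-⊕ z x y ⟩
  ⟨ z , x ⟩ xor ⟨ z , y ⟩   ≡⟨ cong₂ _xor_ (⟨⟩-comm z x) (⟨⟩-comm z y) ⟩
  ⟨ x , z ⟩ xor ⟨ y , z ⟩   ∎
  where open ≡-Reasoning

⟨⟩-zeroˡ : ∀ {n} (x : V n) → ⟨ zeroV , x ⟩ ≡ false
⟨⟩-zeroˡ []      = refl
⟨⟩-zeroˡ (a ∷ x) = ⟨⟩-zeroˡ x

⟨⟩-zeroʳ : ∀ {n} (x : V n) → ⟨ x , zeroV ⟩ ≡ false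
⟨⟩-zeroʳ x = trans (⟨⟩-comm x zeroV) (⟨⟩-zeroˡ x)

⟨⟩-translate : ∀ {n} (v w e : V n) → ⟨ v , e ⟩ ≡ true → ⟨ v , w ⊕ e ⟩ ≡ not ⟨ v , w ⟩
⟨⟩-translate v w e ve = begin
  ⟨ v , w ⊕ e ⟩           ≡⟨ ⟨⟩-distribʳ-⊕ v w e ⟩
  ⟨ v , w ⟩ xor ⟨ v , e ⟩ ≡⟨ cong (⟨ v , w ⟩ xor_) ve ⟩
  ⟨ v , w ⟩ xor true      ≡⟨ xor-comm ⟨ v , w ⟩ true ⟩
  not ⟨ v , w ⟩           ∎
  where open ≡-Reasoning

unit : ∀ {n} → Fin n → V n
unit Fin.zero    = true ∷ zeroV
unit (Fin.suc i) = false ∷ unit i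

⟨⟩-unit : ∀ {n} (v : V n) i → ⟨ v , unit i ⟩ ≡ lookup v i
⟨⟩-unit (a ∷ v) Fin.zero    = trans (cong₂ _xor_ (∧-identityʳ a) (⟨⟩-zeroʳ v)) (xor-identityʳ a)
⟨⟩-unit (a ∷ v) (Fin.suc i) = trans (cong (_xor ⟨ v , unit i ⟩) (∧-zeroʳ a)) (⟨⟩-unit v i)

zeroV⊎dual : ∀ {n} (v : V n) → v ≡ zeroV ⊎ ∃[ w ] ⟨ v , w ⟩ ≡ true
zeroV⊎dual []          = inj₁ refl
zeroV⊎dual (true ∷ v)  = inj₂ (unit Fin.zero , ⟨⟩-unit (true ∷ v) Fin.zero)
zeroV⊎dual (false ∷ v) with zeroV⊎dual v
... | inj₁ refl     = inj₁ refl
... | inj₂ (w , vw) = inj₂ (false ∷ w , vw)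

sumV : ∀ {n} → (V n → ℕ) → ℕ
sumV {zero}  f = f []
sumV {suc n} f = sumV (λ w → f (true ∷ w)) + sumV (λ w → f (false ∷ w))

countV : ∀ {n} → (V n → Bool) → ℕ
countV p = sumV (λ w → 𝟙 (p w))

sumV-cong : ∀ {n} {f g : V n → ℕ} → (∀ w → f w ≡ g w) → sumV f ≡ sumV g
sumV-cong {zero}  f≗g = f≗g []
sumV-cong {suc n} f≗g = cong₂ _+_ (sumV-cong (f≗g ∘ (true ∷_))) (sumV-cong (f≗g ∘ (false ∷_)))

sumV-+ : ∀ {n} (f g : V n → ℕ) → sumV (λ w → f w + g w) ≡ sumV f + sumV g
sumV-+ {zero}  f g = refl
sumV-+ {suc n} f g =
  trans (cong₂ _+_ (sumV-+ (f ∘ (true ∷_)) (g ∘ (true ∷_))) (sumV-+ (f ∘ (false ∷_)) (g ∘ (false ∷_))))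
        (+-interchange (sumV (f ∘ (true ∷_))) (sumV (g ∘ (true ∷_)))
                       (sumV (f ∘ (false ∷_))) (sumV (g ∘ (false ∷_))))

sumV-mono-≤ : ∀ {n} {f g : V n → ℕ} → (∀ w → f w ℕ.≤ g w) → sumV f ℕ.≤ sumV g
sumV-mono-≤ {zero}  f≤g = f≤g []
sumV-mono-≤ {suc n} f≤g = +-mono-≤ (sumV-mono-≤ (f≤g ∘ (true ∷_))) (sumV-mono-≤ (f≤g ∘ (false ∷_)))

sumV-const : ∀ n c → sumV {n} (λ _ → c) ≡ c ℕ.* 2 ^ n
sumV-const zero    c = sym (*-identityʳ c)
sumV-const (suc n) c = trans (cong₂ _+_ (sumV-const n c) (sumV-const n c)) (double c (2 ^ n))
  where
  double : ∀ c m → c ℕ.* m + c ℕ.* m ≡ c ℕ.* (2 ℕ.* m)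
  double = solve-∀

countV-false : ∀ {n} {p : V n → Bool} → (∀ w → p w ≡ false) → countV p ≡ 0
countV-false {n} p≗false = trans (sumV-cong (cong 𝟙 ∘ p≗false)) (sumV-const n 0)

-- w ↦ w ⊕ e permutes 𝔽₂ⁿ.
sumV-translate : ∀ {n} (f : V n → ℕ) (e : V n) → sumV f ≡ sumV (λ w → f (w ⊕ e))
sumV-translate {zero}  f []          = refl
sumV-translate {suc n} f (false ∷ e) =
  cong₂ _+_ (sumV-translate (f ∘ (true ∷_)) e) (sumV-translate (f ∘ (false ∷_)) e)
sumV-translate {suc n} f (true ∷ e)  =
  trans (+-comm (sumV (f ∘ (true ∷_))) _)
        (cong₂ _+_ (sumV-translate (f ∘ (false ∷_)) e) (sumV-translate (f ∘ (true ∷_)) e))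

sumV-sumL : ∀ {a n} {A : Set a} (g : A → V n → ℕ) xs →
  sumV (λ w → sumL (λ x → g x w) xs) ≡ sumL (λ x → sumV (g x)) xs
sumV-sumL {n = n} g []       = sumV-const n 0
sumV-sumL         g (x ∷ xs) = trans (sumV-+ (g x) _) (cong (sumV (g x) +_) (sumV-sumL g xs))

sumL-allVecs : ∀ n (f : V n → ℕ) → sumL f (allVecs n) ≡ sumV f
sumL-allVecs zero    f = +-identityʳ (f [])
sumL-allVecs (suc n) f = begin
  sumL f (map (true ∷_) (allVecs n) ++ map (false ∷_) (allVecs n))
    ≡⟨ sumL-++ f (map (true ∷_) (allVecs n)) _ ⟩
  sumL f (map (true ∷_) (allVecs n)) + sumL f (map (false ∷_) (allVecs n))
    ≡⟨ cong₂ _+_ (sumL-map f _ (allVecs n)) (sumL-map f _ (allVecs n)) ⟩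
  sumL (f ∘ (true ∷_)) (allVecs n) + sumL (f ∘ (false ∷_)) (allVecs n)
    ≡⟨ cong₂ _+_ (sumL-allVecs n _) (sumL-allVecs n _) ⟩
  sumV f ∎
  where open ≡-Reasoning

anyV : ∀ {n} (p : V n → Bool) → (∃[ w ] p w ≡ true) ⊎ (∀ w → p w ≡ false)
anyV {zero} p with p [] in p[]
... | true  = inj₁ ([] , p[])
... | false = inj₂ λ { [] → p[] }
anyV {suc n} p with anyV (p ∘ (true ∷_)) | anyV (p ∘ (false ∷_))
... | inj₁ (w , pw) | _             = inj₁ (true ∷ w , pw)
... | inj₂ _        | inj₁ (w , pw) = inj₁ (false ∷ w , pw)
... | inj₂ none₁    | inj₂ none₀    = inj₂ λ { (true ∷ w) → none₁ w ; (false ∷ w) → none₀ w }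

-- Span and orthogonality

_⊥_ : ∀ {n} → V n → List (V n) → Set
w ⊥ T = All (λ t → ⟨ t , w ⟩ ≡ false) T

orth : ∀ {n} → List (V n) → V n → Bool
orth []      w = true
orth (t ∷ T) w = not ⟨ t , w ⟩ ∧ orth T w

orth⇒⊥ : ∀ {n} {T : List (V n)} {w} → orth T w ≡ true → w ⊥ T
orth⇒⊥ {T = []} _ = []
orth⇒⊥ {T = t ∷ T} {w} o with ⟨ t , w ⟩ in tw
orth⇒⊥ {T = t ∷ T} {w} o  | false = tw ∷ orth⇒⊥ o
orth⇒⊥ {T = t ∷ T} {w} () | true

⊥⇒orth : ∀ {n} {T : List (V n)} {w} → w ⊥ T → orth T w ≡ true
⊥⇒orth []                    = refl
⊥⇒orth (tw ∷ w⊥T) rewrite tw = ⊥⇒orth w⊥T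

orth-cong : ∀ {n} {T U : List (V n)} {w} → (w ⊥ T → w ⊥ U) → (w ⊥ U → w ⊥ T) → orth T w ≡ orth U w
orth-cong T⇒U U⇒T = ⇔→≡ (mk⇔ (⊥⇒orth ∘ T⇒U ∘ orth⇒⊥) (⊥⇒orth ∘ U⇒T ∘ orth⇒⊥))

⊥-⊕ : ∀ {n} {T : List (V n)} {w w′} → w ⊥ T → w′ ⊥ T → (w ⊕ w′) ⊥ T
⊥-⊕ {w = w} {w′} w⊥T w′⊥T =
  All.zipWith (λ {t} (tw , tw′) → trans (⟨⟩-distribʳ-⊕ t w w′) (cong₂ _xor_ tw tw′)) (w⊥T , w′⊥T)

orth-translate : ∀ {n} {T : List (V n)} {e} → e ⊥ T → ∀ w → orth T (w ⊕ e) ≡ orth T w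
orth-translate []                          w = refl
orth-translate {T = t ∷ T} {e} (te ∷ e⊥T) w = cong₂ (λ a b → not a ∧ b) t·w⊕e (orth-translate e⊥T w)
  where
  t·w⊕e : ⟨ t , w ⊕ e ⟩ ≡ ⟨ t , w ⟩
  t·w⊕e = trans (⟨⟩-distribʳ-⊕ t w e) (trans (cong (⟨ t , w ⟩ xor_) te) (xor-identityʳ _))

InSpan-zeroV : ∀ {n} (T : List (V n)) → InSpan zeroV T
InSpan-zeroV T = (λ _ → false) , comb-false T
  where
  comb-false : ∀ T → comb T (λ _ → false) ≡ zeroV
  comb-false []      = refl
  comb-false (_ ∷ T) = comb-false T

InSpan-∷ : ∀ {n} {T : List (V n)} {t v} → InSpan v T → InSpan v (t ∷ T)
InSpan-∷ (c , eq) = false Coefficients.∷ c , eq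

InSpan-⊕∷ : ∀ {n} {T : List (V n)} {t v} → InSpan (t ⊕ v) T → InSpan v (t ∷ T)
InSpan-⊕∷ {t = t} {v} (c , eq) = true Coefficients.∷ c , trans (cong (t ⊕_) eq) (⊕-cancelˡ t v)

InSpan-∈ : ∀ {n} {T : List (V n)} {t} → t ∈ T → InSpan t T
InSpan-∈ {T = t ∷ T} (here refl) =
  InSpan-⊕∷ {T = T} (subst (λ x → InSpan x T) (sym (⊕-self t)) (InSpan-zeroV T))
InSpan-∈ {T = _ ∷ T} (there t∈T) = InSpan-∷ {T = T} (InSpan-∈ t∈T)

⊥-comb : ∀ {n} {T : List (V n)} {w} → w ⊥ T → ∀ c → ⟨ comb T c , w ⟩ ≡ false
⊥-comb {w = w} [] c = ⟨⟩-zeroˡ w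
⊥-comb {T = t ∷ T} {w} (tw ∷ w⊥T) c with c Fin.zero
... | true  = trans (⟨⟩-distribˡ-⊕ t _ w) (cong₂ _xor_ tw (⊥-comb w⊥T _))
... | false = ⊥-comb w⊥T _

⊥-InSpan : ∀ {n} {T : List (V n)} {w v} → w ⊥ T → InSpan v T → ⟨ v , w ⟩ ≡ false
⊥-InSpan w⊥T (c , refl) = ⊥-comb w⊥T c

⊥-⊆span : ∀ {n} {T U : List (V n)} {w} → All (λ t → InSpan t U) T → w ⊥ U → w ⊥ T
⊥-⊆span T⊆U w⊥U = All.map (⊥-InSpan w⊥U) T⊆U

-- If w separates v from T but not from t, and w′ separates t ⊕ v from T, then one of w′ and
-- w ⊕ w′ separates v from t ∷ T.
InSpan⊎separated : ∀ {n} (T : List (V n)) v → InSpan v T ⊎ ∃[ w ] (w ⊥ T × ⟨ v , w ⟩ ≡ true)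
InSpan⊎separated [] v with zeroV⊎dual v
... | inj₁ refl     = inj₁ (InSpan-zeroV [])
... | inj₂ (w , vw) = inj₂ (w , [] , vw)
InSpan⊎separated (t ∷ T) v with InSpan⊎separated T v
... | inj₁ v∈⟨T⟩ = inj₁ (InSpan-∷ {T = T} v∈⟨T⟩)
... | inj₂ (w , w⊥T , vw) with ⟨ t , w ⟩ in tw
...   | false = inj₂ (w , tw ∷ w⊥T , vw)
...   | true with InSpan⊎separated T (t ⊕ v)
...     | inj₁ t⊕v∈⟨T⟩ = inj₁ (InSpan-⊕∷ {T = T} t⊕v∈⟨T⟩)
...     | inj₂ (w′ , w′⊥T , t⊕v·w′) with ⟨ t , w′ ⟩ in tw′
...       | false = inj₂ (w′ , tw′ ∷ w′⊥T , trans (sym t⊕v·w′≡v·w′) t⊕v·w′)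
  where
  t⊕v·w′≡v·w′ : ⟨ t ⊕ v , w′ ⟩ ≡ ⟨ v , w′ ⟩
  t⊕v·w′≡v·w′ = trans (⟨⟩-distribˡ-⊕ t v w′) (cong (_xor ⟨ v , w′ ⟩) tw′)
...       | true = inj₂ (w ⊕ w′ , t·w⊕w′ ∷ ⊥-⊕ w⊥T w′⊥T , v·w⊕w′)
  where
  open ≡-Reasoning
  ¬v·w′ : not ⟨ v , w′ ⟩ ≡ true
  ¬v·w′ = begin
    true xor ⟨ v , w′ ⟩        ≡⟨ cong (_xor ⟨ v , w′ ⟩) tw′ ⟨
    ⟨ t , w′ ⟩ xor ⟨ v , w′ ⟩  ≡⟨ ⟨⟩-distribˡ-⊕ t v w′ ⟨
    ⟨ t ⊕ v , w′ ⟩             ≡⟨ t⊕v·w′ ⟩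
    true                       ∎
  t·w⊕w′ : ⟨ t , w ⊕ w′ ⟩ ≡ false
  t·w⊕w′ = trans (⟨⟩-distribʳ-⊕ t w w′) (cong₂ _xor_ tw tw′)
  v·w⊕w′ : ⟨ v , w ⊕ w′ ⟩ ≡ true
  v·w⊕w′ = trans (⟨⟩-distribʳ-⊕ v w w′) (cong₂ _xor_ vw (trans (sym (not-involutive _)) (cong not ¬v·w′)))

orthCount : ∀ {n} → List (V n) → ℕ
orthCount T = countV (orth T)

orthCount-∷ : ∀ {n} (v : V n) T → orthCount T ≡ orthCount (v ∷ T) + countV (λ w → ⟨ v , w ⟩ ∧ orth T w)
orthCount-∷ v T =
  trans (sumV-cong (λ w → 𝟙-split ⟨ v , w ⟩ (orth T w)))
        (sumV-+ (𝟙 ∘ orth (v ∷ T)) (λ w → 𝟙 (⟨ v , w ⟩ ∧ orth T w)))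

-- Translation by a vector separating v from T exchanges the two summands of orthCount-∷.
∉span-count : ∀ {n} {v : V n} {T} → ¬ InSpan v T → countV (λ w → ⟨ v , w ⟩ ∧ orth T w) ≡ orthCount (v ∷ T)
∉span-count {v = v} {T} v∉⟨T⟩ with InSpan⊎separated T v
... | inj₁ v∈⟨T⟩           = contradiction v∈⟨T⟩ v∉⟨T⟩
... | inj₂ (e , e⊥T , ve) = trans (sumV-translate _ e) (sumV-cong λ w →
  cong 𝟙 (cong₂ _∧_ (⟨⟩-translate v w e ve) (orth-translate e⊥T w)))

orthCount-∉span : ∀ {n} {v : V n} {T} → ¬ InSpan v T → orthCount T ≡ orthCount (v ∷ T) + orthCount (v ∷ T)
orthCount-∉span {v = v} {T} v∉⟨T⟩ =
  trans (orthCount-∷ v T) (cong (orthCount (v ∷ T) +_) (∉span-count {T = T} v∉⟨T⟩))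

LinIndep-head : ∀ {n} {b : V n} {Bs} → LinIndep (b ∷ Bs) → ¬ InSpan b Bs
LinIndep-head {b = b} {Bs} li (c , eq) with li (true Coefficients.∷ c) b⊕b≡0 Fin.zero
  where
  b⊕b≡0 : b ⊕ comb Bs c ≡ zeroV
  b⊕b≡0 = trans (cong (b ⊕_) eq) (⊕-self b)
... | ()

LinIndep-tail : ∀ {n} {b : V n} {Bs} → LinIndep (b ∷ Bs) → LinIndep Bs
LinIndep-tail li c eq i = li (false Coefficients.∷ c) eq (Fin.suc i)

orthCount-LinIndep : ∀ {n} (Bs : List (V n)) → LinIndep Bs → orthCount Bs ℕ.* 2 ^ length Bs ≡ 2 ^ n
orthCount-LinIndep {n} [] _ = trans (*-identityʳ _) (trans (sumV-const n 1) (*-identityˡ _))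
orthCount-LinIndep {n} (b ∷ Bs) li = begin
  Z ℕ.* 2 ^ length (b ∷ Bs)       ≡⟨ double-* Z (2 ^ length Bs) ⟩
  (Z + Z) ℕ.* 2 ^ length Bs       ≡⟨ cong (ℕ._* 2 ^ length Bs) halving ⟨
  orthCount Bs ℕ.* 2 ^ length Bs  ≡⟨ orthCount-LinIndep Bs (LinIndep-tail {Bs = Bs} li) ⟩
  2 ^ n                           ∎
  where
  open ≡-Reasoning
  Z = orthCount (b ∷ Bs)
  halving : orthCount Bs ≡ Z + Z
  halving = orthCount-∉span {T = Bs} (LinIndep-head {Bs = Bs} li)
  double-* : ∀ z m → z ℕ.* (2 ℕ.* m) ≡ (z + z) ℕ.* m
  double-* = solve-∀

orthCount-rank : ∀ {n} {S : List (V n)} {r} → HasRank S r → orthCount S ℕ.* 2 ^ r ≡ 2 ^ n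
orthCount-rank {S = S} (Bs , (li , Bs⊆⟨S⟩ , S⊆⟨Bs⟩) , refl) =
  trans (cong (ℕ._* 2 ^ length Bs) (sumV-cong (cong 𝟙 ∘ orth≡))) (orthCount-LinIndep Bs li)
  where
  orth≡ : ∀ w → orth S w ≡ orth Bs w
  orth≡ w = orth-cong {T = S} {U = Bs} (⊥-⊆span {T = Bs} {S} Bs⊆⟨S⟩) (⊥-⊆span {T = S} {Bs} S⊆⟨Bs⟩)

-- |S ∩ A_w| = 0 and |S ∩ A_w| = 1

cap : ∀ {n} → List (V n) → V n → ℕ
cap S w = count (λ v → ⟨ v , w ⟩) S

capCount : ∀ {n} → ℕ → List (V n) → ℕ
capCount k S = countV (λ w → cap S w ≡ᵇ k)

capSize≡cap : ∀ {n} (S : List (V n)) w → capSize S w ≡ cap S w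
capSize≡cap S w =
  trans (length-filter (λ v → ⟨ v , w ⟩ B.≟ true) S)
        (sumL-cong S (λ {v} _ → cong 𝟙 (does-≟-true ⟨ v , w ⟩)))

orth≡cap≡ᵇ0 : ∀ {n} (T : List (V n)) w → orth T w ≡ (cap T w ≡ᵇ 0)
orth≡cap≡ᵇ0 []      w = refl
orth≡cap≡ᵇ0 (t ∷ T) w with ⟨ t , w ⟩
... | true  = refl
... | false = orth≡cap≡ᵇ0 T w

capCount-0 : ∀ {n} (S : List (V n)) → capCount 0 S ≡ orthCount S
capCount-0 S = sumV-cong (λ w → cong 𝟙 (sym (orth≡cap≡ᵇ0 S w)))

remove-head : ∀ {n} {u : V n} {S} → All (u ≢_) S → remove u (u ∷ S) ≡ S
remove-head {u = u} u∉S =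
  trans (filter-reject (λ x → ¬? (x ≟V u)) (λ u≢u → u≢u refl))
        (filter-all (λ x → ¬? (x ≟V u)) (All.map (λ u≢x x≡u → u≢x (sym x≡u)) u∉S))

remove-∷ : ∀ {n} {u v : V n} {S} → v ≢ u → remove v (u ∷ S) ≡ u ∷ remove v S
remove-∷ {v = v} v≢u = filter-accept (λ x → ¬? (x ≟V v)) (v≢u ∘ sym)

∈-∷-remove⁺ : ∀ {n} {S : List (V n)} {v t} → t ∈ S → t ∈ v ∷ remove v S
∈-∷-remove⁺ {S = S} {v} {t} t∈S with t ≟V v
... | yes refl = here refl
... | no t≢v   = there (∈-filter⁺ (λ x → ¬? (x ≟V v)) t∈S t≢v)

∈-∷-remove⁻ : ∀ {n} {S : List (V n)} {v t} → v ∈ S → t ∈ v ∷ remove v S → t ∈ S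
∈-∷-remove⁻         v∈S (here refl)     = v∈S
∈-∷-remove⁻ {v = v} _   (there t∈S-v) = proj₁ (∈-filter⁻ (λ x → ¬? (x ≟V v)) t∈S-v)

cap≡1-decomposition : ∀ {n} {S : List (V n)} → Unique S → ∀ w →
  𝟙 (cap S w ≡ᵇ 1) ≡ count (λ v → ⟨ v , w ⟩ ∧ orth (remove v S) w) S
cap≡1-decomposition []                           w = refl
cap≡1-decomposition {S = u ∷ S} (u∉S ∷ uniqS) w = begin
  𝟙 ((𝟙 ⟨ u , w ⟩ + cap S w) ≡ᵇ 1)
    ≡⟨ split ⟨ u , w ⟩ ⟩
  𝟙 (⟨ u , w ⟩ ∧ orth S w) + count (λ v → ⟨ v , w ⟩ ∧ orth (u ∷ remove v S) w) S
    ≡⟨ cong₂ _+_ (cong (λ T → 𝟙 (⟨ u , w ⟩ ∧ orth T w)) (remove-head u∉S))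
                 (sumL-cong S (λ {v} v∈S → cong (λ T → 𝟙 (⟨ v , w ⟩ ∧ orth T w))
                                              (remove-∷ (All.lookup u∉S v∈S ∘ sym)))) ⟨
  count (λ v → ⟨ v , w ⟩ ∧ orth (remove v (u ∷ S)) w) (u ∷ S) ∎
  where
  open ≡-Reasoning
  split : ∀ b → 𝟙 ((𝟙 b + cap S w) ≡ᵇ 1)
              ≡ 𝟙 (b ∧ orth S w) + count (λ v → ⟨ v , w ⟩ ∧ (not b ∧ orth (remove v S) w)) S
  split true  = begin
    𝟙 (cap S w ≡ᵇ 0)  ≡⟨ cong 𝟙 (orth≡cap≡ᵇ0 S w) ⟨
    𝟙 (orth S w)      ≡⟨ +-identityʳ _ ⟨
    𝟙 (orth S w) + 0  ≡⟨ cong (𝟙 (orth S w) +_) (count-false S λ {v} _ → ∧-zeroʳ ⟨ v , w ⟩) ⟨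
    𝟙 (orth S w) + count (λ v → ⟨ v , w ⟩ ∧ false) S ∎
  split false = cap≡1-decomposition uniqS w

isolated-count : ∀ {n} {S : List (V n)} {v} → v ∈ S → InI S v →
  countV (λ w → ⟨ v , w ⟩ ∧ orth (remove v S) w) ≡ orthCount S
isolated-count {S = S} {v} v∈S (_ , v∉⟨S-v⟩) =
  trans (∉span-count {T = remove v S} v∉⟨S-v⟩) (sumV-cong (cong 𝟙 ∘ same-orth))
  where
  same-orth : ∀ w → orth (v ∷ remove v S) w ≡ orth S w
  same-orth w = orth-cong {T = v ∷ remove v S} {S} {w}
    (⊥-⊆span (All.tabulate (InSpan-∈ ∘ ∈-∷-remove⁺)))
    (⊥-⊆span (All.tabulate (InSpan-∈ ∘ ∈-∷-remove⁻ v∈S)))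

non-isolated-false : ∀ {n} {S : List (V n)} {v} → v ∈ S → ¬ InI S v →
  ∀ w → ⟨ v , w ⟩ ∧ orth (remove v S) w ≡ false
non-isolated-false {S = S} {v} v∈S ¬I w with ⟨ v , w ⟩ in vw | orth (remove v S) w in o
... | false | _     = refl
... | true  | false = refl
... | true  | true  = contradiction (v∈S , v∉⟨S-v⟩) ¬I
  where
  v∉⟨S-v⟩ : ¬ InSpan v (remove v S)
  v∉⟨S-v⟩ v∈⟨S-v⟩ = contradiction (trans (sym vw) (⊥-InSpan (orth⇒⊥ {T = remove v S} o) v∈⟨S-v⟩)) λ ()

_∈?_ : ∀ {n} (v : V n) (xs : List (V n)) → Dec (v ∈ xs)
v ∈? xs = Any.any? (v ≟V_) xs

count-≟ : ∀ {n} {S : List (V n)} {u} → Unique S → u ∈ S → count (λ v → does (v ≟V u)) S ≡ 1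
count-≟ {u = u} (u∉S ∷ _) (here refl) =
  cong₂ _+_ (cong 𝟙 (dec-true (u ≟V u) refl))
            (count-false _ λ v∈S → dec-false (_ ≟V u) (All.lookup u∉S v∈S ∘ sym))
count-≟ {S = x ∷ _} {u} (x∉S ∷ uniqS) (there u∈S) =
  cong₂ _+_ (cong 𝟙 (dec-false (x ≟V u) (All.lookup x∉S u∈S))) (count-≟ uniqS u∈S)

count-∈? : ∀ {n} {S Is : List (V n)} → Unique S → Unique Is → All (_∈ S) Is →
  count (λ v → does (v ∈? Is)) S ≡ length Is
count-∈? {S = S} {Is = []} _ _ _ = count-false S λ _ → refl
count-∈? {S = S} {u ∷ Is} uniqS (u∉Is ∷ uniqIs) (u∈S ∷ Is⊆S) = begin
  count (λ v → does (v ≟V u) ∨ does (v ∈? Is)) S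
    ≡⟨ sumL-cong S (λ {v} _ → 𝟙-∨ (disjoint v)) ⟩
  sumL (λ v → 𝟙 (does (v ≟V u)) + 𝟙 (does (v ∈? Is))) S
    ≡⟨ sumL-+ (λ v → 𝟙 (does (v ≟V u))) (λ v → 𝟙 (does (v ∈? Is))) S ⟩
  count (λ v → does (v ≟V u)) S + count (λ v → does (v ∈? Is)) S
    ≡⟨ cong₂ _+_ (count-≟ uniqS u∈S) (count-∈? uniqS uniqIs Is⊆S) ⟩
  suc (length Is) ∎
  where
  open ≡-Reasoning
  disjoint : ∀ v → does (v ≟V u) ≡ true → does (v ∈? Is) ≡ false
  disjoint v eq with v ≟V u
  disjoint v eq | yes refl = dec-false (v ∈? Is) (All¬⇒¬Any u∉Is)
  disjoint v () | no _

capCount-1 : ∀ {n} {S Is : List (V n)} → Unique S → Unique Is → (∀ v → (v ∈ Is) ⇔ InI S v) →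
  capCount 1 S ≡ length Is ℕ.* orthCount S
capCount-1 {S = S} {Is} uniqS uniqIs Is≡I = begin
  sumV (λ w → 𝟙 (cap S w ≡ᵇ 1))
    ≡⟨ sumV-cong (cap≡1-decomposition uniqS) ⟩
  sumV (λ w → count (λ v → ⟨ v , w ⟩ ∧ orth (remove v S) w) S)
    ≡⟨ sumV-sumL (λ v w → 𝟙 (⟨ v , w ⟩ ∧ orth (remove v S) w)) S ⟩
  sumL (λ v → countV (λ w → ⟨ v , w ⟩ ∧ orth (remove v S) w)) S
    ≡⟨ sumL-cong S per-element ⟩
  sumL (λ v → 𝟙 (does (v ∈? Is)) ℕ.* orthCount S) S
    ≡⟨ sumL-*ʳ (λ v → 𝟙 (does (v ∈? Is))) (orthCount S) S ⟩
  count (λ v → does (v ∈? Is)) S ℕ.* orthCount S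
    ≡⟨ cong (ℕ._* orthCount S) (count-∈? uniqS uniqIs Is⊆S) ⟩
  length Is ℕ.* orthCount S ∎
  where
  open ≡-Reasoning
  Is⊆S : All (_∈ S) Is
  Is⊆S = All.tabulate (λ {v} v∈Is → proj₁ (Equivalence.to (Is≡I v) v∈Is))
  per-element : ∀ {v} → v ∈ S →
    countV (λ w → ⟨ v , w ⟩ ∧ orth (remove v S) w) ≡ 𝟙 (does (v ∈? Is)) ℕ.* orthCount S
  per-element {v} v∈S with v ∈? Is
  ... | yes v∈Is = trans (isolated-count v∈S (Equivalence.to (Is≡I v) v∈Is)) (sym (+-identityʳ _))
  ... | no  v∉Is = countV-false (non-isolated-false v∈S (v∉Is ∘ Equivalence.from (Is≡I v)))

-- Parity of |S ∩ A_w|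

_∩A_ : ∀ {n} → List (V n) → V n → List (V n)
S ∩A w = filterᵇ (λ v → ⟨ v , w ⟩) S

cap-⊕ : ∀ {n} (S : List (V n)) w e →
  cap S (w ⊕ e) + (cap (S ∩A w) e + cap (S ∩A w) e) ≡ cap S w + cap S e
cap-⊕ S w e = begin
  cap S (w ⊕ e) + (cap (S ∩A w) e + cap (S ∩A w) e)
    ≡⟨ cong₂ _+_ (sumL-cong S λ {v} _ → cong 𝟙 (⟨⟩-distribʳ-⊕ v w e)) (cong₂ _+_ cap∩A≡ cap∩A≡) ⟩
  count (λ v → ⟨ v , w ⟩ xor ⟨ v , e ⟩) S + (count w∧e S + count w∧e S)
    ≡⟨ count-xor (λ v → ⟨ v , w ⟩) (λ v → ⟨ v , e ⟩) S ⟩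
  cap S w + cap S e ∎
  where
  open ≡-Reasoning
  w∧e : V _ → Bool
  w∧e v = ⟨ v , w ⟩ ∧ ⟨ v , e ⟩
  cap∩A≡ : cap (S ∩A w) e ≡ count w∧e S
  cap∩A≡ = count-filterᵇ (λ v → ⟨ v , w ⟩) (λ v → ⟨ v , e ⟩) S

isOdd-cap-⊕ : ∀ {n} (S : List (V n)) w e → isOdd (cap S (w ⊕ e)) ≡ isOdd (cap S w) xor isOdd (cap S e)
isOdd-cap-⊕ S w e = begin
  isOdd (cap S (w ⊕ e))                    ≡⟨ xor-identityʳ _ ⟨
  isOdd (cap S (w ⊕ e)) xor false          ≡⟨ cong (isOdd (cap S (w ⊕ e)) xor_) (isOdd-double Y) ⟨
  isOdd (cap S (w ⊕ e)) xor isOdd (Y + Y)  ≡⟨ isOdd-+ (cap S (w ⊕ e)) (Y + Y) ⟨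
  isOdd (cap S (w ⊕ e) + (Y + Y))          ≡⟨ cong isOdd (cap-⊕ S w e) ⟩
  isOdd (cap S w + cap S e)                ≡⟨ isOdd-+ (cap S w) (cap S e) ⟩
  isOdd (cap S w) xor isOdd (cap S e)      ∎
  where
  open ≡-Reasoning
  Y = cap (S ∩A w) e

countCoord≡cap-unit : ∀ {n} (S : List (V n)) i → countCoord S i ≡ cap S (unit i)
countCoord≡cap-unit S i =
  trans (length-filter (λ v → lookup v i B.≟ true) S)
        (sumL-cong S λ {v} _ → cong 𝟙 (trans (does-≟-true (lookup v i)) (sym (⟨⟩-unit v i))))

countV-translates : ∀ {n} (p : V n → Bool) d ds → (∀ w → ¬ All (λ d → p (w ⊕ d) ≡ true) (d ∷ ds)) →
  countV p ℕ.* length (d ∷ ds) ℕ.≤ length ds ℕ.* 2 ^ n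
countV-translates {n} p d ds no-class = begin
  countV p ℕ.* length (d ∷ ds)
    ≡⟨ sumL-const (countV p) (d ∷ ds) ⟨
  sumL (λ _ → countV p) (d ∷ ds)
    ≡⟨ sumL-cong (d ∷ ds) (λ {d′} _ → sumV-translate (𝟙 ∘ p) d′) ⟩
  sumL (λ d′ → countV (λ w → p (w ⊕ d′))) (d ∷ ds)
    ≡⟨ sumV-sumL (λ d′ w → 𝟙 (p (w ⊕ d′))) (d ∷ ds) ⟨
  sumV (λ w → count (λ d′ → p (w ⊕ d′)) (d ∷ ds))
    ≤⟨ sumV-mono-≤ (λ w → ≤-pred (count-<-length _ (d ∷ ds) (no-class w))) ⟩
  sumV {n} (λ _ → length ds)
    ≡⟨ sumV-const n (length ds) ⟩
  length ds ℕ.* 2 ^ n ∎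
  where open ≤-Reasoning

capCount-odd-translate : ∀ {n} (S : List (V n)) {e} → isOdd (cap S e) ≡ true →
  ∀ k → capCount k S ℕ.* 2 ℕ.≤ 1 ℕ.* 2 ^ n
capCount-odd-translate S {e} odd k = countV-translates (λ x → cap S x ≡ᵇ k) zeroV (e ∷ []) no-pair
  where
  no-pair : ∀ w → ¬ All (λ d → (cap S (w ⊕ d) ≡ᵇ k) ≡ true) (zeroV ∷ e ∷ [])
  no-pair w (w∈ ∷ w⊕e∈ ∷ []) = not-¬ same-parity flipped-parity
    where
    same-parity : isOdd (cap S (w ⊕ e)) ≡ isOdd (cap S w)
    same-parity = cong isOdd (trans (≡ᵇ-true⇒≡ (cap S (w ⊕ e)) k w⊕e∈)
      (sym (subst (λ x → cap S x ≡ k) (⊕-identityʳ w) (≡ᵇ-true⇒≡ (cap S (w ⊕ zeroV)) k w∈))))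
    flipped-parity : isOdd (cap S (w ⊕ e)) ≡ not (isOdd (cap S w))
    flipped-parity = trans (isOdd-cap-⊕ S w e) (trans (cong (isOdd (cap S w) xor_) odd) (xor-comm _ true))

capCount-odd : ∀ {n} (S : List (V n)) k → isOdd k ≡ true → capCount k S ℕ.* 2 ℕ.≤ 1 ℕ.* 2 ^ n
capCount-odd S k odd-k with anyV (λ e → isOdd (cap S e))
... | inj₁ (e , odd) = capCount-odd-translate S odd k
... | inj₂ all-even  = ≤-trans (≤-reflexive (cong (ℕ._* 2) (countV-false cap≢k))) z≤n
  where
  cap≢k : ∀ w → (cap S w ≡ᵇ k) ≡ false
  cap≢k w with cap S w ≡ᵇ k in eq
  ... | false = refl
  ... | true  = contradiction (trans (sym odd-k) even-k) λ ()
    where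
    even-k : isOdd k ≡ false
    even-k = trans (cong isOdd (sym (≡ᵇ-true⇒≡ (cap S w) k eq))) (all-even w)

cap∩A≡1 : ∀ {n} (S : List (V n)) {w e} → cap S w ≡ 2 → cap S e ≡ 2 → cap S (w ⊕ e) ≡ 2 → cap (S ∩A w) e ≡ 1
cap∩A≡1 S {w} {e} cw ce cwe = m+m≡2⇒m≡1 Y (+-cancelˡ-≡ 2 (Y + Y) 2 (begin
  2 + (Y + Y)              ≡⟨ cong (_+ (Y + Y)) cwe ⟨
  cap S (w ⊕ e) + (Y + Y)  ≡⟨ cap-⊕ S w e ⟩
  cap S w + cap S e        ≡⟨ cong₂ _+_ cw ce ⟩
  2 + 2                    ∎))
  where
  open ≡-Reasoning
  Y = cap (S ∩A w) e

coset-not-all-2 : ∀ {n} (S : List (V n)) {e f w} → cap S e ≡ 2 → cap S f ≡ 2 → cap S (e ⊕ f) ≡ 2 →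
  cap S w ≡ 2 → cap S (w ⊕ e) ≡ 2 → cap S (w ⊕ f) ≡ 2 → cap S (w ⊕ (e ⊕ f)) ≢ 2
coset-not-all-2 S {e} {f} {w} ce cf cef cw cwe cwf cwef = contradiction parity λ ()
  where
  parity : true ≡ false
  parity = begin
    true                                               ≡⟨ cong isOdd (cap∩A≡1 S cw cef cwef) ⟨
    isOdd (cap (S ∩A w) (e ⊕ f))                       ≡⟨ isOdd-cap-⊕ (S ∩A w) e f ⟩
    isOdd (cap (S ∩A w) e) xor isOdd (cap (S ∩A w) f)  ≡⟨ cong₂ (λ a b → isOdd a xor isOdd b)
                                                            (cap∩A≡1 S cw ce cwe) (cap∩A≡1 S cw cf cwf) ⟩
    false                                              ∎
    where open ≡-Reasoning

half⇒three-quarters : ∀ {N P} → N ℕ.* 2 ℕ.≤ 1 ℕ.* P → N ℕ.* 4 ℕ.≤ 3 ℕ.* P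
half⇒three-quarters {N} {P} N*2≤P = begin
  N ℕ.* 4            ≡⟨ *-assoc N 2 2 ⟨
  N ℕ.* 2 ℕ.* 2      ≤⟨ *-monoˡ-≤ 2 N*2≤P ⟩
  1 ℕ.* P ℕ.* 2      ≡⟨ *-comm (1 ℕ.* P) 2 ⟩
  2 ℕ.* (1 ℕ.* P)    ≤⟨ *-monoˡ-≤ (1 ℕ.* P) (n≤1+n 2) ⟩
  3 ℕ.* (1 ℕ.* P)    ≡⟨ cong (3 ℕ.*_) (*-identityˡ P) ⟩
  3 ℕ.* P            ∎
  where open ≤-Reasoning

capCount-2 : ∀ {n} (S : List (V n)) → capCount 2 S ℕ.* 4 ℕ.≤ 3 ℕ.* 2 ^ n
capCount-2 S with anyV (λ e → cap S e ≡ᵇ 2)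
... | inj₂ none = ≤-trans (≤-reflexive (cong (ℕ._* 4) (countV-false none))) z≤n
... | inj₁ (e , ce) with anyV (λ f → (cap S f ≡ᵇ 2) ∧ (cap S (e ⊕ f) ≡ᵇ 2))
...   | inj₂ no-f =
  half⇒three-quarters {capCount 2 S} (countV-translates (λ x → cap S x ≡ᵇ 2) zeroV (e ∷ []) no-pair)
  where
  no-pair : ∀ w → ¬ All (λ d → (cap S (w ⊕ d) ≡ᵇ 2) ≡ true) (zeroV ∷ e ∷ [])
  no-pair w (w∈ ∷ w⊕e∈ ∷ []) = contradiction (trans (sym (no-f w)) (cong₂ _∧_
    (subst (λ x → (cap S x ≡ᵇ 2) ≡ true) (⊕-identityʳ w) w∈)
    (subst (λ x → (cap S x ≡ᵇ 2) ≡ true) (⊕-comm w e) w⊕e∈))) λ ()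
...   | inj₁ (f , cf∧cef) = countV-translates (λ x → cap S x ≡ᵇ 2) zeroV (e ∷ f ∷ (e ⊕ f) ∷ []) no-coset
  where
  two : ∀ x → (cap S x ≡ᵇ 2) ≡ true → cap S x ≡ 2
  two x = ≡ᵇ-true⇒≡ (cap S x) 2
  no-coset : ∀ w → ¬ All (λ d → (cap S (w ⊕ d) ≡ᵇ 2) ≡ true) (zeroV ∷ e ∷ f ∷ (e ⊕ f) ∷ [])
  no-coset w (w∈ ∷ w⊕e∈ ∷ w⊕f∈ ∷ w⊕e⊕f∈ ∷ []) = coset-not-all-2 S
    (two e ce) (two f (∧-conicalˡ _ _ cf∧cef)) (two (e ⊕ f) (∧-conicalʳ _ _ cf∧cef))
    (subst (λ x → cap S x ≡ 2) (⊕-identityʳ w) (two (w ⊕ zeroV) w∈))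
    (two (w ⊕ e) w⊕e∈) (two (w ⊕ f) w⊕f∈) (two (w ⊕ (e ⊕ f)) w⊕e⊕f∈)

-- Probabilities

open import Data.Integer using (+_)

/-≡ : ∀ a b c d .{{_ : NonZero b}} .{{_ : NonZero d}} → a ℕ.* d ≡ c ℕ.* b → + a / b ≡ + c / d
/-≡ a (suc b) c (suc d) eq = fromℚᵘ-cong {ℚᵘ.mkℚᵘ (+ a) b} {ℚᵘ.mkℚᵘ (+ c) d}
  (ℚᵘ.*≡* (trans (sym (ℤ.pos-* a (suc d))) (trans (cong +_ eq) (ℤ.pos-* c (suc b)))))

/-≤ : ∀ a b c d .{{_ : NonZero b}} .{{_ : NonZero d}} → a ℕ.* d ℕ.≤ c ℕ.* b → + a / b ≤ + c / d
/-≤ a (suc b) c (suc d) le = toℚᵘ-cancel-≤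
  (ℚᵘ.≤-respˡ-≃ (ℚᵘ.≃-sym (toℚᵘ-fromℚᵘ (ℚᵘ.mkℚᵘ (+ a) b)))
    (ℚᵘ.≤-respʳ-≃ (ℚᵘ.≃-sym (toℚᵘ-fromℚᵘ (ℚᵘ.mkℚᵘ (+ c) d)))
      (ℚᵘ.*≤* (subst₂ ℤ._≤_ (ℤ.pos-* a (suc d)) (ℤ.pos-* c (suc b)) (ℤ.+≤+ le)))))

/1-*-/ : ∀ a b d .{{_ : NonZero d}} → (+ a / 1) * (+ b / d) ≡ + (a ℕ.* b) / d
/1-*-/ a b (suc d) = toℚᵘ-injective (begin
  toℚᵘ (+ a / 1 * (+ b / suc d))
    ≈⟨ toℚᵘ-homo-* (+ a / 1) (+ b / suc d) ⟩
  toℚᵘ (+ a / 1) ℚᵘ.* toℚᵘ (+ b / suc d)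
    ≈⟨ ℚᵘ.*-cong (toℚᵘ-fromℚᵘ (ℚᵘ.mkℚᵘ (+ a) 0)) (toℚᵘ-fromℚᵘ (ℚᵘ.mkℚᵘ (+ b) d)) ⟩
  ℚᵘ.mkℚᵘ (+ a) 0 ℚᵘ.* ℚᵘ.mkℚᵘ (+ b) d
    ≈⟨ ℚᵘ.*≡* (cong₂ ℤ._*_ (ℤ.pos-* a b) (cong +_ (*-identityˡ (suc d)))) ⟨
  ℚᵘ.mkℚᵘ (+ (a ℕ.* b)) d
    ≈⟨ toℚᵘ-fromℚᵘ (ℚᵘ.mkℚᵘ (+ (a ℕ.* b)) d) ⟨
  toℚᵘ (+ (a ℕ.* b) / suc d) ∎)
  where open ℚᵘ.≃-Reasoning

module _ {n : ℕ} (S : List (V n)) where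

  instance
    2ⁿ-nonZero : NonZero (2 ^ n)
    2ⁿ-nonZero = m^n≢0 2 n

  q≡capCount : ∀ k → q k S ≡ + capCount k S / 2 ^ n
  q≡capCount k = cong (λ m → + m / 2 ^ n) (begin
    length (filter (λ w → capSize S w ℕ.≟ k) (allVecs n))
      ≡⟨ length-filter (λ w → capSize S w ℕ.≟ k) (allVecs n) ⟩
    count (λ w → capSize S w ≡ᵇ k) (allVecs n)
      ≡⟨ sumL-allVecs n (λ w → 𝟙 (capSize S w ≡ᵇ k)) ⟩
    countV (λ w → capSize S w ≡ᵇ k)
      ≡⟨ sumV-cong (λ w → cong (λ m → 𝟙 (m ≡ᵇ k)) (capSize≡cap S w)) ⟩
    capCount k S ∎)
    where open ≡-Reasoning

  q₀≡ : q 0 S ≡ + orthCount S / 2 ^ n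
  q₀≡ = trans (q≡capCount 0) (cong (λ m → + m / 2 ^ n) (capCount-0 S))

  q₀-rank : ∀ {r} → HasRank S r → q 0 S ≡ (+ 1 / 2 ^ r) {{m^n≢0 2 r}}
  q₀-rank {r} rank = trans q₀≡ ((/-≡ (orthCount S) (2 ^ n) 1 (2 ^ r) {{2ⁿ-nonZero}} {{m^n≢0 2 r}}
    (trans (orthCount-rank rank) (sym (*-identityˡ (2 ^ n))))))

  q₁≡ : ∀ {Is} → Unique S → Unique Is → (∀ v → (v ∈ Is) ⇔ InI S v) →
    q 1 S ≡ + (length Is ℕ.* orthCount S) / 2 ^ n
  q₁≡ uniqS uniqIs Is≡I = trans (q≡capCount 1) (cong (λ m → + m / 2 ^ n) (capCount-1 uniqS uniqIs Is≡I))

  q₁≡m·q₀ : ∀ {Is} → Unique S → Unique Is → (∀ v → (v ∈ Is) ⇔ InI S v) → q 1 S ≡ (+ length Is / 1) * q 0 S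
  q₁≡m·q₀ {Is} uniqS uniqIs Is≡I = begin
    q 1 S                                            ≡⟨ q₁≡ uniqS uniqIs Is≡I ⟩
    + (length Is ℕ.* orthCount S) / 2 ^ n            ≡⟨ /1-*-/ (length Is) (orthCount S) (2 ^ n) ⟨
    (+ length Is / 1) * (+ orthCount S / 2 ^ n)      ≡⟨ cong ((+ length Is / 1) *_) q₀≡ ⟨
    (+ length Is / 1) * q 0 S                        ∎
    where open ≡-Reasoning

  q₁-rank : ∀ {r Is} → HasRank S r → Unique S → Unique Is → (∀ v → (v ∈ Is) ⇔ InI S v) →
    q 1 S ≡ (+ length Is / 2 ^ r) {{m^n≢0 2 r}}
  q₁-rank {r} {Is} rank uniqS uniqIs Is≡I = trans (q₁≡ uniqS uniqIs Is≡I)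
    (/-≡ (length Is ℕ.* orthCount S) (2 ^ n) (length Is) (2 ^ r) {{2ⁿ-nonZero}} {{m^n≢0 2 r}}
      (trans (*-assoc (length Is) (orthCount S) (2 ^ r)) (cong (length Is ℕ.*_) (orthCount-rank rank))))

  q≤ : ∀ k c d .{{_ : NonZero d}} → capCount k S ℕ.* d ℕ.≤ c ℕ.* 2 ^ n → q k S ≤ + c / d
  q≤ k c d bound = subst (_≤ + c / d) (sym (q≡capCount k)) (/-≤ (capCount k S) (2 ^ n) c d bound)

lemma5p3 : (n : ℕ) (S : List (Vec Bool n)) → Unique S → All (λ v → v ≢ zeroV) S →
    ((r : ℕ) → HasRank S r →
      (q 0 S ≡ (+ 1 / (2 ^ r)) {{m^n≢0 2 r}})
      × ((Is : List (Vec Bool n)) → Unique Is → (∀ v → (v ∈ Is) ⇔ InI S v) →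
          (q 1 S ≡ (+ length Is / 1) * q 0 S)
          × (q 1 S ≡ (+ length Is / (2 ^ r)) {{m^n≢0 2 r}})))
    × ((i : Fin n) → countCoord S i % 2 ≡ 1 → (k : ℕ) → q k S ≤ ½)
    × ((k : ℕ) → k % 2 ≡ 1 → q k S ≤ ½)
    × (q 2 S ≤ + 3 / 4)
-- The zero vector is harmless: it lies in every span, so it changes no rank and is never in I(S).
lemma5p3 n S uniqS _ =
    (λ r rank → q₀-rank S rank
              , λ Is uniqIs Is≡I → q₁≡m·q₀ S uniqS uniqIs Is≡I , q₁-rank S rank uniqS uniqIs Is≡I)
  , (λ i odd-coord k → q≤ S k 1 2 (capCount-odd-translate S (odd-unit i odd-coord) k))
  , (λ k odd-k → q≤ S k 1 2 (capCount-odd S k (%2≡1⇒isOdd k odd-k)))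
  , q≤ S 2 3 4 (capCount-2 S)
  where
  odd-unit : ∀ i → countCoord S i % 2 ≡ 1 → isOdd (cap S (unit i)) ≡ true
  odd-unit i odd-coord =
    trans (cong isOdd (sym (countCoord≡cap-unit S i))) (%2≡1⇒isOdd (countCoord S i) odd-coord)
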